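{- Let $m\geq 2$, $n_1,\ldots,n_m\geq 2$ integers and $N=n_1\cdots n_m$. For every $\sigma\in Sym(m)$, the permutation $\widetilde{\sigma}$ of $\{0,\ldots,N-1\}$ induced by $P^{\sigma}_{n_1,\ldots,n_m}$ fixes $0$ and $N-1$. Moreover, in the homogeneous case $n_1=\cdots=n_m=n$, the integers that are fixed by $\widetilde{\sigma}$ for every $\sigma\in Sym(m)$ are exactly the $n$ integers $h\frac{n^m-1}{n-1}$, $h=0,1,\ldots,n-1$ (i.e. those whose base-$n$ expansion of length $m$ is constant, $x_1=\cdots=x_m=h$).
   Context: For positive integers $a,b$ and $1\le i\le a$, $1\le j\le b$, $E^{i,j}_{a\times b}$ denotes the $a\times b$ real matrix with entry $1$ in row $i$, column $j$ and $0$ elsewhere; $\otimes$ is the Kronecker product. For $\sigma\in Sym(m)$ the shuffling matrix is the $N\times N$ permutation matrix $$P^{\sigma}_{n_1,\ldots,n_m}=\sum_{\substack{i_j=1,\ldots,n_j\\ j=1,\ldots,m}} E^{i_{\sigma^{ -1}(1)},i_1}_{n_{\sigma^{ -1}(1)}\times n_1}\otimes\cdots\otimes E^{i_{\sigma^{ -1}(m)},i_m}_{n_{\sigma^{ -1}(m)}\times n_m}.$$ Rows and columns of $N\times N$ matrices are indexed by $\{0,\ldots,N-1\}$ (the $r$-th row/column has index $r-1$); ${\bf e}_x$ is the column vector of length $N$ with $1$ at the position indexed by $x$. The induced permutation $\widetilde{\sigma}$ of $\{0,\ldots,N-1\}$ is defined by $P^{\sigma}_{n_1,\ldots,n_m}{\bf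 e}_x={\bf e}_{\widetilde{\sigma}(x)}$. -}

module Defs where

open import Data.Nat using (ℕ; zero; suc; _+_; _*_; _∸_; _≤_; s≤s; NonZero)
open import Data.Fin using (Fin; zero; suc; toℕ; remQuot)
open import Data.Fin.Permutation using (Permutation′; _⟨$⟩ˡ_)
open import Data.Product using (_×_; _,_)
open import Data.Bool using (Bool; true; false; if_then_else_; _∧_)
open import Relation.Nullary.Decidable using (⌊_⌋)
open import Relation.Binary.PropositionalEquality using (_≡_)
import Data.Fin as F
import Data.Nat as N

-- Real matrices with 0/1 (hence natural-number) entries: a × b matrices as functions.
Mat : ℕ → ℕ → Set
Mat a b = Fin a → Fin b → ℕ

E : (a b : ℕ) → Fin a → Fin b → Mat a b
E a b i j r c = if ⌊ r F.≟ i ⌋ ∧ ⌊ c F.≟ j ⌋ then 1 else 0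

-- Kronecker product A ⊗ B; row index (i1,i2) ↦ i1*c + i2 (standard convention)
_⊗_ : ∀ {a b c d} → Mat a b → Mat c d → Mat (a * c) (b * d)
_⊗_ {a} {b} {c} {d} A B r s with remQuot {a} c r | remQuot {b} d s
... | (r₁ , r₂) | (s₁ , s₂) = A r₁ s₁ * B r₂ s₂

prodDims : (m : ℕ) → (Fin m → ℕ) → ℕ
prodDims zero    n = 1
prodDims (suc m) n = n zero * prodDims m (λ k → n (suc k))

kron : (m : ℕ) (a b : Fin m → ℕ) → ((k : Fin m) → Mat (a k) (b k))
     → Mat (prodDims m a) (prodDims m b)
kron zero    a b M r c = 1
kron (suc m) a b M = M zero ⊗ kron m (λ k → a (suc k)) (λ k → b (suc k)) (λ k → M (suc k))

sumFin : (a : ℕ) → (Fin a → ℕ) → ℕ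
sumFin zero    f = 0
sumFin (suc a) f = f zero + sumFin a (λ i → f (suc i))

-- sum over all tuples (i₁,…,i_m) with i_j ∈ {1..n_j} (0-based here)
sumTuples : (m : ℕ) (n : Fin m → ℕ) → (((k : Fin m) → Fin (n k)) → ℕ) → ℕ
sumTuples zero    n f = f (λ ())
sumTuples (suc m) n f =
  sumFin (n zero) λ i → sumTuples m (λ k → n (suc k)) λ is →
    f (λ { zero → i ; (suc k) → is k })

-- the shuffling matrix P^σ_{n₁,…,n_m}; its rows are indexed by Fin (n_{σ⁻¹(1)} ⋯ n_{σ⁻¹(m)}),
-- its columns by Fin (n₁ ⋯ n_m); both sets have N elements and are compared via toℕ.
shuffle : (m : ℕ) (n : Fin m → ℕ) (σ : Permutation′ m)
        → Mat (prodDims m (λ k → n (σ ⟨$⟩ˡ k))) (prodDims m n)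
shuffle m n σ r c =
  sumTuples m n (λ i →
    kron m (λ k → n (σ ⟨$⟩ˡ k)) n
      (λ k → E (n (σ ⟨$⟩ˡ k)) (n k) (i (σ ⟨$⟩ˡ k)) (i k)) r c)

δ : ℕ → ℕ → ℕ
δ x y = if ⌊ x N.≟ y ⌋ then 1 else 0

-- x ∈ {0,…,N-1} is fixed by σ̃, i.e. P^σ e_x = e_x
-- (since P^σ e_x = e_{σ̃(x)}, σ̃(x) = x iff the column x of P^σ is e_x).
FixedBy : (m : ℕ) (n : Fin m → ℕ) (σ : Permutation′ m) → ℕ → Set
FixedBy m n σ x =
  (x N.< prodDims m n) ×
  (∀ (c : Fin (prodDims m n)) → toℕ c ≡ x →
     ∀ (r : Fin (prodDims m (λ k → n (σ ⟨$⟩ˡ k)))) → shuffle m n σ r c ≡ δ (toℕ r) x)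

nonZero-pred : ∀ {d} → 2 ≤ d → NonZero (d ∸ 1)
nonZero-pred (s≤s (s≤s _)) = _

module Submission where

-- A column index c of P^σ is a digit string (c₁,…,c_m) in the mixed radix (n₁,…,n_m), and
-- P^σ is the sum over all strings of the matrix units E^{(c_{σ⁻¹(1)},…,c_{σ⁻¹(m)}),(c₁,…,c_m)};
-- hence σ̃ reads the digits of c in the order σ⁻¹, in the permuted radix.  The strings of
-- minimal digits 0 and maximal digits n_k − 1 (the indices 0 and N − 1) are preserved by
-- every σ.  In radix n, invariance under the transpositions (1 k) forces all digits to equal
-- c₁ = h, and the constant string h⋯h has value h (n^m − 1)/(n − 1).

open import Defs
open import Data.Bool using (Bool; true; false; if_then_else_; _∧_)
open import Data.Bool.Properties using (∧-zeroʳ; ∧-identityʳ)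
open import Data.Fin using (Fin; zero; suc; toℕ; remQuot; combine; fromℕ<)
import Data.Fin as Fin
open import Data.Fin.Permutation using (Permutation′; _⟨$⟩ˡ_; transpose; flip)
import Data.Fin.Permutation as Permutation
open import Data.Fin.Properties
  using (toℕ-injective; toℕ<n; toℕ-fromℕ<; remQuot-combine; combine-remQuot; toℕ-combine; suc-injective)
open import Data.Nat using (ℕ; zero; suc; _≤_; _<_; _+_; _*_; _∸_; _^_; s≤s; z≤n)
import Data.Nat as ℕ
open import Data.Nat.DivMod using (_/_; m*n/n≡m)
import Data.Nat.Properties as ℕₚ
open import Data.Product using (_×_; _,_; proj₁; proj₂; Σ-syntax)
open import Data.Vec.Functional using (tail)
open import Function using (_∘_)
open import Function.Bundles using (_⇔_; mk⇔; Equivalence)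
open import Relation.Binary.PropositionalEquality
open import Relation.Nullary using (Dec; does; yes; no; contradiction)
open import Relation.Nullary.Decidable using (⌊_⌋; isYes≗does; does-⇔; _×-dec_)
import Algebra.Properties.CommutativeMonoid.Sum as MonoidSum
import Algebra.Properties.CommutativeSemigroup as SemigroupProperties

open Equivalence using (to; from)

𝟙 : Bool → ℕ
𝟙 b = if b then 1 else 0

𝟙-∧ : ∀ a b → 𝟙 (a ∧ b) ≡ 𝟙 a * 𝟙 b
𝟙-∧ false b = refl
𝟙-∧ true  b = sym (ℕₚ.*-identityˡ (𝟙 b))

isYes-⇔ : {A B : Set} → A ⇔ B → (a? : Dec A) (b? : Dec B) → ⌊ a? ⌋ ≡ ⌊ b? ⌋
isYes-⇔ A⇔B a? b? = trans (isYes≗does a?) (trans (does-⇔ A⇔B a? b?) (sym (isYes≗does b?)))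

δ-refl : ∀ x → δ x x ≡ 1
δ-refl x with x ℕ.≟ x
... | yes _  = refl
... | no x≢x = contradiction refl x≢x

δ≡1⇒≡ : ∀ {x y} → δ x y ≡ 1 → x ≡ y
δ≡1⇒≡ {x} {y} δxy≡1 with x ℕ.≟ y
... | yes x≡y = x≡y
... | no _    = contradiction δxy≡1 λ ()

fromDigits : (m : ℕ) (a : Fin m → ℕ) → (Fin m → ℕ) → ℕ
fromDigits zero    a g = 0
fromDigits (suc m) a g = prodDims m (tail a) * g zero + fromDigits m (tail a) (tail g)

fromDigits-cong : ∀ m a {g g′} → (∀ k → g k ≡ g′ k) → fromDigits m a g ≡ fromDigits m a g′
fromDigits-cong zero    a g≗g′ = refl
fromDigits-cong (suc m) a g≗g′ =
  cong₂ _+_ (cong (prodDims m (tail a) *_) (g≗g′ zero)) (fromDigits-cong m (tail a) (λ k → g≗g′ (suc k)))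

encode : (m : ℕ) (a : Fin m → ℕ) → ((k : Fin m) → Fin (a k)) → Fin (prodDims m a)
encode zero    a t = zero
encode (suc m) a t = combine (t zero) (encode m (tail a) (λ k → t (suc k)))

digits : (m : ℕ) (a : Fin m → ℕ) → Fin (prodDims m a) → (k : Fin m) → Fin (a k)
digits (suc m) a r zero    = proj₁ (remQuot {a zero} (prodDims m (tail a)) r)
digits (suc m) a r (suc k) = digits m (tail a) (proj₂ (remQuot {a zero} (prodDims m (tail a)) r)) k

digits-encode : ∀ m a t k → digits m a (encode m a t) k ≡ t k
digits-encode (suc m) a t zero    = cong proj₁ (remQuot-combine (t zero) _)
digits-encode (suc m) a t (suc k) =
  trans (cong (λ q → digits m (tail a) (proj₂ q) k) (remQuot-combine (t zero) _))
        (digits-encode m (tail a) (λ k → t (suc k)) k)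

encode-digits : ∀ m a r → encode m a (digits m a r) ≡ r
encode-digits zero    a zero = refl
encode-digits (suc m) a r =
  trans (cong (combine {a zero} _) (encode-digits m (tail a) _)) (combine-remQuot {a zero} _ r)

encode-cong : ∀ m a {t t′} → (∀ k → t k ≡ t′ k) → encode m a t ≡ encode m a t′
encode-cong zero    a t≗t′ = refl
encode-cong (suc m) a t≗t′ =
  cong₂ combine (t≗t′ zero) (encode-cong m (tail a) (λ k → t≗t′ (suc k)))

toℕ-encode : ∀ m a t → toℕ (encode m a t) ≡ fromDigits m a (λ k → toℕ (t k))
toℕ-encode zero    a t = refl
toℕ-encode (suc m) a t =
  trans (toℕ-combine (t zero) _) (cong (prodDims m (tail a) * toℕ (t zero) +_) (toℕ-encode m (tail a) (λ k → t (suc k))))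

toℕ-digits : ∀ m a r → toℕ r ≡ fromDigits m a (λ k → toℕ (digits m a r k))
toℕ-digits m a r = trans (cong toℕ (sym (encode-digits m a r))) (toℕ-encode m a (digits m a r))

sumFin-zeros : ∀ a (f : Fin a → ℕ) → (∀ i → f i ≡ 0) → sumFin a f ≡ 0
sumFin-zeros zero    f f≗0 = refl
sumFin-zeros (suc a) f f≗0 = cong₂ _+_ (f≗0 zero) (sumFin-zeros a _ (λ i → f≗0 (suc i)))

sumFin-single : ∀ a (f : Fin a → ℕ) t → (∀ i → i ≢ t → f i ≡ 0) → sumFin a f ≡ f t
sumFin-single (suc a) f zero    off =
  trans (cong (f zero +_) (sumFin-zeros a _ (λ i → off (suc i) λ ()))) (ℕₚ.+-identityʳ _)
sumFin-single (suc a) f (suc t) off =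
  cong₂ _+_ (off zero λ ()) (sumFin-single a _ t (λ i i≢t → off (suc i) (i≢t ∘ suc-injective)))

sumTuples-zeros : ∀ m n f → (∀ i → f i ≡ 0) → sumTuples m n f ≡ 0
sumTuples-zeros zero    n f f≗0 = f≗0 _
sumTuples-zeros (suc m) n f f≗0 =
  sumFin-zeros (n zero) _ (λ _ → sumTuples-zeros m (tail n) _ (λ _ → f≗0 _))

sumTuples-single : ∀ m n f (t : (k : Fin m) → Fin (n k)) v →
  (∀ i → Σ[ k ∈ Fin m ] i k ≢ t k → f i ≡ 0) → (∀ i → (∀ k → i k ≡ t k) → f i ≡ v) →
  sumTuples m n f ≡ v
sumTuples-single zero    n f t v off on = on _ λ ()
sumTuples-single (suc m) n f t v off on =
  trans (sumFin-single (n zero) _ (t zero)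
          (λ i i≢t₀ → sumTuples-zeros m (tail n) _ (λ _ → off _ (zero , i≢t₀))))
        (sumTuples-single m (tail n) _ (λ k → t (suc k)) v
          (λ { i (k , i≢t) → off _ (suc k , i≢t) })
          (λ i i≗t → on _ λ { zero → refl ; (suc k) → i≗t k }))

⊗-entry : ∀ {a b c d} (A : Mat a b) (B : Mat c d) r s →
  (A ⊗ B) r s ≡ A (proj₁ (remQuot {a} c r)) (proj₁ (remQuot {b} d s))
              * B (proj₂ (remQuot {a} c r)) (proj₂ (remQuot {b} d s))
⊗-entry {a} {b} {c} {d} A B r s with remQuot {a} c r | remQuot {b} d s
... | _ , _ | _ , _ = refl

≟combine : ∀ {a b} (r : Fin (a * b)) i j →
  ⌊ r Fin.≟ combine i j ⌋ ≡ ⌊ proj₁ (remQuot {a} b r) Fin.≟ i ⌋ ∧ ⌊ proj₂ (remQuot {a} b r) Fin.≟ j ⌋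
≟combine {a} {b} r i j = begin
  ⌊ r Fin.≟ combine i j ⌋  ≡⟨ isYes-⇔ r≡combine⇔ _ (q₁? ×-dec q₂?) ⟩
  ⌊ q₁? ×-dec q₂? ⌋        ≡⟨ isYes≗does (q₁? ×-dec q₂?) ⟩
  does q₁? ∧ does q₂?      ≡⟨ cong₂ _∧_ (isYes≗does q₁?) (isYes≗does q₂?) ⟨
  ⌊ q₁? ⌋ ∧ ⌊ q₂? ⌋        ∎
  where
  open ≡-Reasoning
  q₁? = proj₁ (remQuot {a} b r) Fin.≟ i
  q₂? = proj₂ (remQuot {a} b r) Fin.≟ j
  r≡combine⇔ : r ≡ combine i j ⇔ (proj₁ (remQuot {a} b r) ≡ i × proj₂ (remQuot {a} b r) ≡ j)
  r≡combine⇔ = mk⇔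
    (λ { refl → cong proj₁ (remQuot-combine i j) , cong proj₂ (remQuot-combine i j) })
    (λ (q₁≡i , q₂≡j) → trans (sym (combine-remQuot {a} b r)) (cong₂ combine q₁≡i q₂≡j))

E-⊗-E : ∀ {a b c d} (i : Fin a) (j : Fin b) (i′ : Fin c) (j′ : Fin d) r s →
  (E a b i j ⊗ E c d i′ j′) r s ≡ E (a * c) (b * d) (combine i i′) (combine j j′) r s
E-⊗-E {a} {b} {c} {d} i j i′ j′ r s = begin
  (E a b i j ⊗ E c d i′ j′) r s          ≡⟨ ⊗-entry (E a b i j) (E c d i′ j′) r s ⟩
  𝟙 (x₁ ∧ y₁) * 𝟙 (x₂ ∧ y₂)              ≡⟨ cong₂ _*_ (𝟙-∧ x₁ y₁) (𝟙-∧ x₂ y₂) ⟩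
  (𝟙 x₁ * 𝟙 y₁) * (𝟙 x₂ * 𝟙 y₂)          ≡⟨ interchange (𝟙 x₁) (𝟙 y₁) (𝟙 x₂) (𝟙 y₂) ⟩
  (𝟙 x₁ * 𝟙 x₂) * (𝟙 y₁ * 𝟙 y₂)          ≡⟨ cong₂ _*_ (𝟙-∧ x₁ x₂) (𝟙-∧ y₁ y₂) ⟨
  𝟙 (x₁ ∧ x₂) * 𝟙 (y₁ ∧ y₂)              ≡⟨ cong₂ (λ x y → 𝟙 x * 𝟙 y) (≟combine r i i′) (≟combine s j j′) ⟨
  𝟙 x * 𝟙 y                              ≡⟨ 𝟙-∧ x y ⟨
  E (a * c) (b * d) (combine i i′) (combine j j′) r s  ∎
  where
  open ≡-Reasoning
  open SemigroupProperties ℕₚ.*-commutativeSemigroup using (interchange)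
  x₁ = ⌊ proj₁ (remQuot {a} c r) Fin.≟ i ⌋
  x₂ = ⌊ proj₂ (remQuot {a} c r) Fin.≟ i′ ⌋
  y₁ = ⌊ proj₁ (remQuot {b} d s) Fin.≟ j ⌋
  y₂ = ⌊ proj₂ (remQuot {b} d s) Fin.≟ j′ ⌋
  x = ⌊ r Fin.≟ combine i i′ ⌋
  y = ⌊ s Fin.≟ combine j j′ ⌋

kron-E : ∀ m a b (i : (k : Fin m) → Fin (a k)) (j : (k : Fin m) → Fin (b k)) r c →
  kron m a b (λ k → E (a k) (b k) (i k) (j k)) r c
    ≡ E (prodDims m a) (prodDims m b) (encode m a i) (encode m b j) r c
kron-E zero    a b i j zero zero = refl
kron-E (suc m) a b i j r c = begin
  (E₀ ⊗ rest) r c          ≡⟨ ⊗-entry E₀ rest r c ⟩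
  E₀ r₁ c₁ * rest r₂ c₂    ≡⟨ cong (E₀ r₁ c₁ *_) (kron-E m _ _ (λ k → i (suc k)) (λ k → j (suc k)) r₂ c₂) ⟩
  E₀ r₁ c₁ * E-rest r₂ c₂  ≡⟨ ⊗-entry E₀ E-rest r c ⟨
  (E₀ ⊗ E-rest) r c        ≡⟨ E-⊗-E (i zero) (j zero) _ _ r c ⟩
  E _ _ (encode (suc m) a i) (encode (suc m) b j) r c ∎
  where
  open ≡-Reasoning
  E₀ = E (a zero) (b zero) (i zero) (j zero)
  rest = kron m (tail a) (tail b) (λ k → E (a (suc k)) (b (suc k)) (i (suc k)) (j (suc k)))
  E-rest = E (prodDims m (tail a)) (prodDims m (tail b))
             (encode m (tail a) (λ k → i (suc k))) (encode m (tail b) (λ k → j (suc k)))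
  r₁ = proj₁ (remQuot {a zero} (prodDims m (tail a)) r)
  r₂ = proj₂ (remQuot {a zero} (prodDims m (tail a)) r)
  c₁ = proj₁ (remQuot {b zero} (prodDims m (tail b)) c)
  c₂ = proj₂ (remQuot {b zero} (prodDims m (tail b)) c)

E-offColumn : ∀ a b i j r c → c ≢ j → E a b i j r c ≡ 0
E-offColumn a b i j r c c≢j with c Fin.≟ j
... | yes c≡j = contradiction c≡j c≢j
... | no _    = cong 𝟙 (∧-zeroʳ ⌊ r Fin.≟ i ⌋)

E-onColumn : ∀ a b i j r → E a b i j r j ≡ δ (toℕ r) (toℕ i)
E-onColumn a b i j r with j Fin.≟ j
... | no j≢j = contradiction refl j≢j
... | yes _  = cong 𝟙 (trans (∧-identityʳ _) (isYes-⇔ (mk⇔ (cong toℕ) toℕ-injective) _ _))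

module _ (m : ℕ) (n : Fin m → ℕ) (σ : Permutation′ m) where

  induced : Fin (prodDims m n) → Fin (prodDims m (λ k → n (σ ⟨$⟩ˡ k)))
  induced c = encode m (λ k → n (σ ⟨$⟩ˡ k)) (λ k → digits m n c (σ ⟨$⟩ˡ k))

  shuffle-entry : ∀ r c → shuffle m n σ r c ≡ δ (toℕ r) (toℕ (induced c))
  shuffle-entry r c =
    trans (sumTuples-single m n _ (digits m n c) _ offDigits onDigits) (E-onColumn _ _ _ c r)
    where
    offDigits : ∀ i → Σ[ k ∈ Fin m ] i k ≢ digits m n c k → _
    offDigits i (k , i≢c) = trans (kron-E m _ n _ i r c) (E-offColumn _ _ _ _ r c λ c≡ →
      i≢c (trans (sym (digits-encode m n i k)) (cong (λ z → digits m n z k) (sym c≡))))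

    onDigits : ∀ i → (∀ k → i k ≡ digits m n c k) → _
    onDigits i i≗c = trans (kron-E m _ n _ i r c) (cong₂ (λ u v → E _ _ u v r c)
      (encode-cong m _ (λ k → i≗c (σ ⟨$⟩ˡ k)))
      (trans (encode-cong m n i≗c) (encode-digits m n c)))

  fixedBy⇔ : ∀ c → FixedBy m n σ (toℕ c) ⇔ toℕ (induced c) ≡ toℕ c
  fixedBy⇔ c = mk⇔
    (λ (_ , fixed) → δ≡1⇒≡ (begin
      δ (toℕ (induced c)) (toℕ c)              ≡⟨ fixed c refl (induced c) ⟨
      shuffle m n σ (induced c) c              ≡⟨ shuffle-entry (induced c) c ⟩
      δ (toℕ (induced c)) (toℕ (induced c))    ≡⟨ δ-refl _ ⟩
      1                                        ∎))
    (λ induced-c≡c → toℕ<n c , λ c′ c′≡c r →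
      trans (shuffle-entry r c′)
            (cong (δ (toℕ r)) (trans (cong (toℕ ∘ induced) (toℕ-injective c′≡c)) induced-c≡c)))
    where open ≡-Reasoning

  fixedBy-fromDigits : (g : Fin m → ℕ) → (∀ k → g k < n k) →
    fromDigits m (λ k → n (σ ⟨$⟩ˡ k)) (λ k → g (σ ⟨$⟩ˡ k)) ≡ fromDigits m n g →
    FixedBy m n σ (fromDigits m n g)
  fixedBy-fromDigits g g<n permuted≡g =
    subst (FixedBy m n σ) toℕ-c (from (fixedBy⇔ c) (begin
      toℕ (induced c)                                          ≡⟨ toℕ-encode m _ _ ⟩
      fromDigits m _ (λ k → toℕ (digits m n c (σ ⟨$⟩ˡ k)))     ≡⟨ fromDigits-cong m _ (λ k → toℕ-digit (σ ⟨$⟩ˡ k)) ⟩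
      fromDigits m _ (λ k → g (σ ⟨$⟩ˡ k))                      ≡⟨ permuted≡g ⟩
      fromDigits m n g                                         ≡⟨ toℕ-c ⟨
      toℕ c                                                    ∎))
    where
    open ≡-Reasoning
    c = encode m n (λ k → fromℕ< (g<n k))
    toℕ-c : toℕ c ≡ fromDigits m n g
    toℕ-c = trans (toℕ-encode m n _) (fromDigits-cong m n (λ k → toℕ-fromℕ< (g<n k)))
    toℕ-digit : ∀ k → toℕ (digits m n c k) ≡ g k
    toℕ-digit k = trans (cong toℕ (digits-encode m n _ k)) (toℕ-fromℕ< (g<n k))

fixedBy-const⇒digits-invariant : ∀ m d (σ : Permutation′ m) c →
  FixedBy m (λ _ → d) σ (toℕ c) → ∀ k → digits m (λ _ → d) c (σ ⟨$⟩ˡ k) ≡ digits m (λ _ → d) c k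
fixedBy-const⇒digits-invariant m d σ c fixed k =
  trans (sym (digits-encode m _ _ k))
        (cong (λ z → digits m _ z k) (toℕ-injective (to (fixedBy⇔ m _ σ c) fixed)))

prodDims-permute : ∀ m a (σ : Permutation′ m) → prodDims m (λ k → a (σ ⟨$⟩ˡ k)) ≡ prodDims m a
prodDims-permute m a σ =
  trans (sym (prodDims≡∏ m _)) (trans (sym (sum-permute a (flip σ))) (prodDims≡∏ m a))
  where
  open MonoidSum ℕₚ.*-1-commutativeMonoid using (sum; sum-permute)
  prodDims≡∏ : ∀ m a → sum a ≡ prodDims m a
  prodDims≡∏ zero    a = refl
  prodDims≡∏ (suc m) a = cong (a zero *_) (prodDims≡∏ m (tail a))

prodDims-positive : ∀ m a → (∀ k → 0 < a k) → 0 < prodDims m a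
prodDims-positive zero    a a>0 = s≤s z≤n
prodDims-positive (suc m) a a>0 = ℕₚ.*-mono-≤ (a>0 zero) (prodDims-positive m (tail a) (λ k → a>0 (suc k)))

fromDigits-zeros : ∀ m a → fromDigits m a (λ _ → 0) ≡ 0
fromDigits-zeros zero    a = refl
fromDigits-zeros (suc m) a = cong₂ _+_ (ℕₚ.*-zeroʳ (prodDims m (tail a))) (fromDigits-zeros m (tail a))

fromDigits-maximal : ∀ m a → (∀ k → 0 < a k) → fromDigits m a (λ k → a k ∸ 1) ≡ prodDims m a ∸ 1
fromDigits-maximal zero    a a>0 = refl
fromDigits-maximal (suc m) a a>0 =
  trans (cong (prodDims m (tail a) * (a zero ∸ 1) +_) (fromDigits-maximal m (tail a) (λ k → a>0 (suc k))))
        (carry (a zero) (prodDims m (tail a)) (a>0 zero) (prodDims-positive m (tail a) (λ k → a>0 (suc k))))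
  where
  carry : ∀ x y → 0 < x → 0 < y → y * (x ∸ 1) + (y ∸ 1) ≡ x * y ∸ 1
  carry (suc x) (suc y) _ _ = trans (cong (_+ y) (ℕₚ.*-comm (suc y) x)) (ℕₚ.+-comm (x * suc y) y)

repunit : ℕ → ℕ → ℕ
repunit d zero    = 0
repunit d (suc m) = d ^ m + repunit d m

fromDigits-const : ∀ m d h → fromDigits m (λ _ → d) (λ _ → h) ≡ h * repunit d m
fromDigits-const zero    d h = sym (ℕₚ.*-zeroʳ h)
fromDigits-const (suc m) d h = begin
  prodDims m (λ _ → d) * h + fromDigits m (λ _ → d) (λ _ → h)  ≡⟨ cong₂ _+_ (cong (_* h) (prodDims-const m)) (fromDigits-const m d h) ⟩
  d ^ m * h + h * repunit d m                                  ≡⟨ cong (_+ h * repunit d m) (ℕₚ.*-comm (d ^ m) h) ⟩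
  h * d ^ m + h * repunit d m                                  ≡⟨ ℕₚ.*-distribˡ-+ h (d ^ m) (repunit d m) ⟨
  h * repunit d (suc m)                                        ∎
  where
  open ≡-Reasoning
  prodDims-const : ∀ m → prodDims m (λ _ → d) ≡ d ^ m
  prodDims-const zero    = refl
  prodDims-const (suc m) = cong (d *_) (prodDims-const m)

repunit-geometric : ∀ e m → repunit (suc e) m * e + 1 ≡ suc e ^ m
repunit-geometric e zero    = refl
repunit-geometric e (suc m) = begin
  (suc e ^ m + repunit (suc e) m) * e + 1       ≡⟨ cong (_+ 1) (ℕₚ.*-distribʳ-+ e (suc e ^ m) (repunit (suc e) m)) ⟩
  suc e ^ m * e + repunit (suc e) m * e + 1     ≡⟨ ℕₚ.+-assoc (suc e ^ m * e) _ 1 ⟩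
  suc e ^ m * e + (repunit (suc e) m * e + 1)   ≡⟨ cong (suc e ^ m * e +_) (repunit-geometric e m) ⟩
  suc e ^ m * e + suc e ^ m                     ≡⟨ ℕₚ.+-comm (suc e ^ m * e) (suc e ^ m) ⟩
  suc e ^ m + suc e ^ m * e                     ≡⟨ cong (suc e ^ m +_) (ℕₚ.*-comm (suc e ^ m) e) ⟩
  suc e ^ suc m                                 ∎
  where open ≡-Reasoning

repunit≡ : ∀ m d (d≥2 : 2 ≤ d) → repunit d m ≡ _/_ (d ^ m ∸ 1) (d ∸ 1) {{nonZero-pred d≥2}}
repunit≡ m (suc (suc e)) (s≤s (s≤s _)) = sym (begin
  (suc (suc e) ^ m ∸ 1) / suc e                        ≡⟨ cong (λ z → (z ∸ 1) / suc e) (repunit-geometric (suc e) m) ⟨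
  (repunit (suc (suc e)) m * suc e + 1 ∸ 1) / suc e    ≡⟨ cong (_/ suc e) (ℕₚ.m+n∸n≡m (repunit (suc (suc e)) m * suc e) 1) ⟩
  repunit (suc (suc e)) m * suc e / suc e              ≡⟨ m*n/n≡m (repunit (suc (suc e)) m) (suc e) ⟩
  repunit (suc (suc e)) m                              ∎)
  where open ≡-Reasoning

fixedBy-zero : ∀ m n σ → (∀ k → 0 < n k) → FixedBy m n σ 0
fixedBy-zero m n σ n>0 =
  subst (FixedBy m n σ) (fromDigits-zeros m n)
        (fixedBy-fromDigits m n σ (λ _ → 0) n>0 (trans (fromDigits-zeros m _) (sym (fromDigits-zeros m n))))

fixedBy-last : ∀ m n σ → (∀ k → 0 < n k) → FixedBy m n σ (prodDims m n ∸ 1)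
fixedBy-last m n σ n>0 =
  subst (FixedBy m n σ) (fromDigits-maximal m n n>0)
        (fixedBy-fromDigits m n σ (λ k → n k ∸ 1) (λ k → ∸1< (n>0 k)) (begin
          fromDigits m nσ (λ k → nσ k ∸ 1)  ≡⟨ fromDigits-maximal m nσ (λ k → n>0 (σ ⟨$⟩ˡ k)) ⟩
          prodDims m nσ ∸ 1                 ≡⟨ cong (_∸ 1) (prodDims-permute m n σ) ⟩
          prodDims m n ∸ 1                  ≡⟨ fromDigits-maximal m n n>0 ⟨
          fromDigits m n (λ k → n k ∸ 1)    ∎))
  where
  open ≡-Reasoning
  nσ = λ k → n (σ ⟨$⟩ˡ k)
  ∸1< : ∀ {x} → 0 < x → x ∸ 1 < x
  ∸1< {suc x} _ = ℕₚ.n<1+n x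

repdigit⇒fixedBy : ∀ m d σ h → h < d → FixedBy m (λ _ → d) σ (h * repunit d m)
repdigit⇒fixedBy m d σ h h<d =
  subst (FixedBy m (λ _ → d) σ) (fromDigits-const m d h)
        (fixedBy-fromDigits m (λ _ → d) σ (λ _ → h) (λ _ → h<d) refl)

fixedByAll⇒repdigit : ∀ m d x → (∀ σ → FixedBy (suc m) (λ _ → d) σ x) →
  Σ[ h ∈ ℕ ] (h < d × x ≡ h * repunit d (suc m))
fixedByAll⇒repdigit m d x fixed = h , toℕ<n (digit zero) , (begin
  x                                               ≡⟨ toℕ-fromℕ< x<N ⟨
  toℕ c                                           ≡⟨ toℕ-digits (suc m) (λ _ → d) c ⟩
  fromDigits (suc m) (λ _ → d) (toℕ ∘ digit)      ≡⟨ fromDigits-cong (suc m) (λ _ → d) (cong toℕ ∘ digit≡digit₀) ⟩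
  fromDigits (suc m) (λ _ → d) (λ _ → h)          ≡⟨ fromDigits-const (suc m) d h ⟩
  h * repunit d (suc m)                           ∎)
  where
  open ≡-Reasoning
  x<N = proj₁ (fixed Permutation.id)
  c = fromℕ< x<N
  digit = digits (suc m) (λ _ → d) c
  h = toℕ (digit zero)
  -- τ ⟨$⟩ˡ zero reduces to k
  digit≡digit₀ : ∀ k → digit k ≡ digit zero
  digit≡digit₀ k = fixedBy-const⇒digits-invariant (suc m) d τ c
    (subst (FixedBy (suc m) (λ _ → d) τ) (sym (toℕ-fromℕ< x<N)) (fixed τ)) zero
    where τ = transpose k zero

proposition3p10 :
    (m : ℕ) → 2 ≤ m →
    ((n : Fin m → ℕ) → (∀ k → 2 ≤ n k) → (σ : Permutation′ m) →
       FixedBy m n σ 0 × FixedBy m n σ (prodDims m n ∸ 1))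
    ×
    ((d : ℕ) → (hd : 2 ≤ d) → (x : ℕ) →
       ((σ : Permutation′ m) → FixedBy m (λ _ → d) σ x)
       ⇔ (Σ[ h ∈ ℕ ] (h < d × x ≡ h * _/_ (d ^ m ∸ 1) (d ∸ 1) {{nonZero-pred hd}})))
proposition3p10 (suc m) _ =
  (λ n n≥2 σ → let n>0 = λ k → ℕₚ.<-≤-trans (s≤s z≤n) (n≥2 k) in
     fixedBy-zero (suc m) n σ n>0 , fixedBy-last (suc m) n σ n>0) ,
  λ d d≥2 x → mk⇔
    (λ fixed → let (h , h<d , x≡) = fixedByAll⇒repdigit m d x fixed in
       h , h<d , trans x≡ (cong (h *_) (repunit≡ (suc m) d d≥2)))
    (λ (h , h<d , x≡) σ →
       subst (FixedBy (suc m) (λ _ → d) σ) (trans (cong (h *_) (repunit≡ (suc m) d d≥2)) (sym x≡))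
             (repdigit⇒fixedBy (suc m) d σ h h<d))
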